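{- $\mathit{Micro}\neq\sigma\mathcal{P}^{*}$, where $\mathit{Micro}$ is the family of microscopic subsets of $2^\omega$ and $\sigma\mathcal{P}$ the family of $\sigma$-porous subsets of $2^\omega$.
   Context: $2^\omega$ is the Cantor space with coordinatewise addition modulo 2; $A+B=\{a+b:a\in A,b\in B\}$; $[\sigma]=\{x\in2^\omega:\sigma\subseteq x\}$. For $\mathcal{F}\subseteq\mathcal{P}(2^\omega)$, $\mathcal{F}^{*}=\{A\subseteq 2^\omega:\ \forall F\in\mathcal{F}\ \ A+F\neq 2^\omega\}$. $X$ is microscopic if for every $k\in\mathbb{N}$ there is a sequence $(\sigma_n)_{n\geq1}$ of finite binary sequences with $|\sigma_n|=kn$ and $X\subseteq\bigcup_n[\sigma_n]$. $X$ is porous if there exists $k$ such that for every $m$ and every $\alpha\in 2^m$ there is $\beta\in 2^{m+k}$ with $\alpha\subseteq\beta$ and $[\beta]\cap X=\emptyset$; $\sigma$-porous means a countable union of porous sets. -}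

module Defs where

open import Level using (Level; _⊔_) renaming (suc to lsuc; zero to lzero)
open import Data.Nat using (ℕ; suc; _*_; _+_)
open import Data.Bool using (Bool; _xor_)
open import Data.Fin using (Fin; toℕ; _↑ˡ_)
open import Data.Vec using (Vec; lookup)
open import Data.Product using (Σ; _×_; ∃; ∃-syntax; _,_)
open import Relation.Nullary using (¬_)
open import Relation.Binary.PropositionalEquality using (_≡_)

Cantor : Set
Cantor = ℕ → Bool

Subset : Set₁
Subset = Cantor → Set

_⊕_ : Cantor → Cantor → Cantor
(x ⊕ y) n = x n xor y n

_+ₛ_ : Subset → Subset → Subset
(A +ₛ B) z = Σ Cantor λ a → Σ Cantor λ b → A a × B b × (∀ n → z n ≡ (a ⊕ b) n)

IsWhole : Subset → Set
IsWhole S = ∀ z → S z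

_∈[_] : {m : ℕ} → Cantor → Vec Bool m → Set
x ∈[ σ ] = ∀ (i : Fin _) → lookup σ i ≡ x (toℕ i)

_≼_ : {m k : ℕ} → Vec Bool m → Vec Bool (m + k) → Set
_≼_ {m} {k} α β = ∀ (i : Fin m) → lookup α i ≡ lookup β (i ↑ˡ k)

-- microscopic: for every k there are σ_n (n ≥ 1) with |σ_n| = k n covering X
-- (σ_n is indexed here by n-1, i.e. sigma j has length k * (j + 1))
Microscopic : Subset → Set
Microscopic X = ∀ (k : ℕ) → Σ ((j : ℕ) → Vec Bool (k * suc j)) λ sigma →
  ∀ x → X x → ∃[ j ] (x ∈[ sigma j ])

Porous : Subset → Set
Porous X = ∃[ k ] ∀ (m : ℕ) (α : Vec Bool m) →
  Σ (Vec Bool (m + k)) λ β → (_≼_ {m} {k} α β) × ¬ (Σ Cantor λ x → (x ∈[ β ]) × X x)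

SigmaPorous : Subset → Set₁
SigmaPorous X = Σ (ℕ → Subset) λ P → (∀ n → Porous (P n)) ×
  ((∀ x → X x → ∃[ n ] P n x) × (∀ x n → P n x → X x))

SigmaPorousStar : Subset → Set₁
SigmaPorousStar A = ∀ (F : Subset) → SigmaPorous F → ¬ IsWhole (A +ₛ F)

SameFamily : (Subset → Set₁) → (Subset → Set₁) → Set₁
SameFamily 𝓕 𝓖 = ∀ A → (𝓕 A → 𝓖 A) × (𝓖 A → 𝓕 A)

Micro : Subset → Set₁
Micro A = Level.Lift (lsuc lzero) (Microscopic A)

{-# OPTIONS --safe #-}
-- The witness A = ZeroOnGaps is the set of points vanishing on the gaps of the partition of ω
-- into consecutive segments, segment t being a block of length 2^t followed by a gap of length
-- 2^(2^t).
--
-- A is not microscopic: in a cover by strings σ j of length 8(j+1), fewer than 2^(2^t) strings are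
-- assigned to block t and each of them reaches past it, so some pattern of block t disagrees with
-- all of them; the point of A carrying these patterns on its blocks is not covered.
--
-- A belongs to (σP)*: given F = ⋃ P n with P n porous of depth k n, a point z is built segment by
-- segment, the gap of segment t dealing with one P n (every n recurs at arbitrarily late t).
-- Fewer than 2^(2^(t+1)) candidates describe the points a ∈ A up to that gap. For each candidate
-- u, porosity gives k bits extending z ⊕ u into a hole of P n; writing into z the k bits wanted by
-- most live candidates kills a 2^-k fraction of them, so 2^(t+1) rounds of 2^k such steps kill
-- all of them, and these fit into the gap once t > 2k. Hence z ⊕ a ∉ F for every a ∈ A, that is
-- z ∉ A + F.
module Submission where

open import Defs
open import Level using (lower)
open import Data.Bool using (Bool; true; false; _xor_)
import Data.Bool as Bool
open import Data.Bool.Properties using (xor-identityʳ; xor-comm; xor-assoc; xor-same; ¬-not)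
open import Data.Nat
open import Data.Nat.Properties
open import Data.Nat.GeneralisedArithmetic using (iterate)
open import Data.Nat.Solver using (module +-*-Solver)
open import Data.Fin using (Fin; toℕ; fromℕ<; _↑ˡ_)
open import Data.Fin.Properties using (toℕ-fromℕ<; toℕ-↑ˡ; toℕ<n)
open import Data.Vec using (Vec; []; _∷_; lookup; tabulate)
open import Data.Vec.Properties using (lookup∘tabulate)
open import Data.List using (List; []; _∷_; _++_; length; filter; map; upTo; cartesianProductWith)
open import Data.List.Properties using (length-++; length-map; length-upTo; filter-all; filter-≐)
open import Data.List.Membership.Propositional using (_∈_)
open import Data.List.Membership.Propositional.Properties
  using (∈-filter⁺; ∈-length; ∈-applyUpTo⁺; ∈-cartesianProductWith⁺; ∈-cartesianProductWith⁻)
import Data.List.Relation.Unary.All as All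
open import Data.List.Relation.Unary.Any using (here; there)
open import Data.Product using (Σ; ∃-syntax; _×_; _,_; proj₁; proj₂)
open import Data.Sum using (_⊎_; inj₁; inj₂)
open import Function using (_∘_; id)
open import Relation.Nullary using (¬_; Dec; yes; no; does; contradiction)
open import Relation.Unary using (Pred; Decidable; _≐_)
open import Relation.Unary.Properties using (∁?; _∩?_)
open import Relation.Binary.PropositionalEquality

zeros : Cantor
zeros _ = false

shift : ℕ → Cantor → Cantor
shift q f o = f (q + o)

_∷ᶜ_ : Bool → Cantor → Cantor
(b ∷ᶜ f) zero = b
(b ∷ᶜ f) (suc o) = f o

graft : ℕ → Cantor → Cantor → Cantor
graft q f g i with i <? q
... | yes _ = f i
... | no _ = g (i ∸ q)

graft-< : ∀ {q i} f g → i < q → graft q f g i ≡ f i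
graft-< {q} {i} f g i<q with i <? q
... | yes _ = refl
... | no i≮q = contradiction i<q i≮q

graft-≥ : ∀ {q i} f g → q ≤ i → graft q f g i ≡ g (i ∸ q)
graft-≥ {q} {i} f g q≤i with i <? q
... | yes i<q = contradiction q≤i (<⇒≱ i<q)
... | no _ = refl

graft-+ : ∀ q {o} f g → graft q f g (q + o) ≡ g o
graft-+ q {o} f g = trans (graft-≥ f g (m≤m+n q o)) (cong g (m+n∸m≡n q o))

Agree : ℕ → Cantor → Cantor → Set
Agree n f g = ∀ {i} → i < n → f i ≡ g i

agree? : ∀ n f g → Dec (Agree n f g)
agree? n f g = allUpTo? (λ i → f i Bool.≟ g i) n

Agree-refl : ∀ {n f} → Agree n f f
Agree-refl _ = refl

Agree-sym : ∀ {n f g} → Agree n f g → Agree n g f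
Agree-sym f≈g i<n = sym (f≈g i<n)

Agree-trans : ∀ {n f g h} → Agree n f g → Agree n g h → Agree n f h
Agree-trans f≈g g≈h i<n = trans (f≈g i<n) (g≈h i<n)

Agree-≤ : ∀ {m n f g} → m ≤ n → Agree n f g → Agree m f g
Agree-≤ m≤n f≈g i<m = f≈g (<-≤-trans i<m m≤n)

Agree-+ : ∀ q {k f g} → Agree q f g → Agree k (shift q f) (shift q g) → Agree (q + k) f g
Agree-+ q f≈g f≈g-above {i} i<q+k with i <? q
... | yes i<q = f≈g i<q
... | no i≮q with m≤n⇒∃[o]m+o≡n (≮⇒≥ i≮q)
...   | o , refl = f≈g-above (+-cancelˡ-< q o _ i<q+k)

Agree-⊕ : ∀ {n f f′ g g′} → Agree n f f′ → Agree n g g′ → Agree n (f ⊕ g) (f′ ⊕ g′)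
Agree-⊕ f≈f′ g≈g′ i<n = cong₂ _xor_ (f≈f′ i<n) (g≈g′ i<n)

Agree-∷ᶜ⁺ : ∀ {k f b W} → f 0 ≡ b → Agree k (shift 1 f) W → Agree (suc k) f (b ∷ᶜ W)
Agree-∷ᶜ⁺ f0≡b _ {zero} _ = f0≡b
Agree-∷ᶜ⁺ _ f≈W {suc i} i<1+k = f≈W (s<s⁻¹ i<1+k)

Agree-∷ᶜ⁻ : ∀ {k f b W} → Agree (suc k) f (b ∷ᶜ W) → f 0 ≡ b × Agree k (shift 1 f) W
Agree-∷ᶜ⁻ f≈bW = f≈bW z<s , λ i<k → f≈bW (s<s i<k)

VanishesFrom : ℕ → Cantor → Set
VanishesFrom q u = ∀ {i} → q ≤ i → u i ≡ false

Misses : Subset → ℕ → Cantor → Set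
Misses P n f = ∀ x → Agree n f x → ¬ P x

Misses-≤ : ∀ {P m n f} → m ≤ n → Misses P m f → Misses P n f
Misses-≤ m≤n f-misses x f≈x = f-misses x (Agree-≤ m≤n f≈x)

Misses-Agree : ∀ {P n f g} → Agree n f g → Misses P n f → Misses P n g
Misses-Agree f≈g f-misses x g≈x = f-misses x (Agree-trans f≈g g≈x)

xor-cancelˡ : ∀ x y → (x xor y) xor x ≡ y
xor-cancelˡ x y = begin
  (x xor y) xor x ≡⟨ xor-comm (x xor y) x ⟩
  x xor (x xor y) ≡⟨ sym (xor-assoc x x y) ⟩
  (x xor x) xor y ≡⟨ cong (_xor y) (xor-same x) ⟩
  y               ∎
  where open ≡-Reasoning

toCantor : ∀ {m} → Vec Bool m → Cantor
toCantor [] = zeros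
toCantor (b ∷ σ) = b ∷ᶜ toCantor σ

toCantor-lookup : ∀ {m} (σ : Vec Bool m) i → toCantor σ (toℕ i) ≡ lookup σ i
toCantor-lookup (b ∷ σ) Fin.zero = refl
toCantor-lookup (b ∷ σ) (Fin.suc i) = toCantor-lookup σ i

toCantor-fromℕ< : ∀ {m i} (σ : Vec Bool m) (i<m : i < m) → toCantor σ i ≡ lookup σ (fromℕ< i<m)
toCantor-fromℕ< σ i<m = trans (cong (toCantor σ) (sym (toℕ-fromℕ< i<m))) (toCantor-lookup σ _)

toCantor-tabulate : ∀ {m} f → Agree m (toCantor (tabulate {n = m} (f ∘ toℕ))) f
toCantor-tabulate {m} f i<m =
  trans (toCantor-fromℕ< (tabulate {n = m} (f ∘ toℕ)) i<m)
        (trans (lookup∘tabulate (f ∘ toℕ) (fromℕ< i<m)) (cong f (toℕ-fromℕ< i<m)))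

∈[]⇒Agree : ∀ {m x} {σ : Vec Bool m} → x ∈[ σ ] → Agree m (toCantor σ) x
∈[]⇒Agree {x = x} {σ} x∈σ i<m =
  trans (toCantor-fromℕ< σ i<m) (trans (x∈σ (fromℕ< i<m)) (cong x (toℕ-fromℕ< i<m)))

Agree⇒∈[] : ∀ {m x} {σ : Vec Bool m} → Agree m (toCantor σ) x → x ∈[ σ ]
Agree⇒∈[] {σ = σ} σ≈x i = trans (sym (toCantor-lookup σ i)) (σ≈x (toℕ<n i))

≼⇒Agree : ∀ {m k} {α : Vec Bool m} {β : Vec Bool (m + k)} → _≼_ {m} {k} α β →
          Agree m (toCantor α) (toCantor β)
≼⇒Agree {k = k} {α} {β} α≼β {i} i<m = begin
  toCantor α i              ≡⟨ toCantor-fromℕ< α i<m ⟩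
  lookup α j                ≡⟨ α≼β j ⟩
  lookup β (j ↑ˡ k)         ≡⟨ sym (toCantor-lookup β (j ↑ˡ k)) ⟩
  toCantor β (toℕ (j ↑ˡ k)) ≡⟨ cong (toCantor β) (trans (toℕ-↑ˡ j k) (toℕ-fromℕ< i<m)) ⟩
  toCantor β i              ∎
  where
  open ≡-Reasoning
  j = fromℕ< i<m

PorousWith : ℕ → Subset → Set
PorousWith k P = ∀ f m → Σ Cantor λ g → Agree m f g × Misses P (m + k) g

Porous⇒PorousWith : ∀ {P} → Porous P → ∃[ k ] PorousWith k P
Porous⇒PorousWith (k , holes) = k , λ f m →
  let α = tabulate {n = m} (f ∘ toℕ)
      β , α≼β , β∩P≡∅ = holes m α
  in toCantor β
   , Agree-trans (Agree-sym (toCantor-tabulate {m} f)) (≼⇒Agree {α = α} {β} α≼β)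
   , λ x β≈x Px → β∩P≡∅ (x , Agree⇒∈[] {σ = β} β≈x , Px)

-- Counting prefixes

halves : ∀ {a b n} → a + b ≡ n → a ≤ b → n ≤ 2 * b × 2 * a ≤ n
halves {a} {b} refl a≤b =
    subst (a + b ≤_) (cong (b +_) (sym (+-identityʳ b))) (+-monoˡ-≤ b a≤b)
  , subst (_≤ a + b) (cong (a +_) (sym (+-identityʳ a))) (+-monoʳ-≤ a a≤b)

module _ {A : Set} where

  length-filter-∁ : ∀ {p} {P : Pred A p} (P? : Decidable P) xs →
                    length (filter P? xs) + length (filter (∁? P?) xs) ≡ length xs
  length-filter-∁ P? [] = refl
  length-filter-∁ P? (x ∷ xs) with does (P? x)
  ... | true = cong suc (length-filter-∁ P? xs)
  ... | false = trans (+-suc _ _) (cong suc (length-filter-∁ P? xs))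

  filter-filter : ∀ {p q} {P : Pred A p} {Q : Pred A q} (P? : Decidable P) (Q? : Decidable Q) xs →
                  filter Q? (filter P? xs) ≡ filter (P? ∩? Q?) xs
  filter-filter P? Q? [] = refl
  filter-filter P? Q? (x ∷ xs) with does (P? x)
  ... | false = filter-filter P? Q? xs
  ... | true with does (Q? x)
  ...   | true = cong (x ∷_) (filter-filter P? Q? xs)
  ...   | false = filter-filter P? Q? xs

  length-cartesianProductWith : ∀ {B C : Set} (f : A → B → C) xs ys →
                                length (cartesianProductWith f xs ys) ≡ length xs * length ys
  length-cartesianProductWith f [] ys = refl
  length-cartesianProductWith f (x ∷ xs) ys = begin
    length (map (f x) ys ++ cartesianProductWith f xs ys)
      ≡⟨ length-++ (map (f x) ys) ⟩
    length (map (f x) ys) + length (cartesianProductWith f xs ys)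
      ≡⟨ cong₂ _+_ (length-map (f x) ys) (length-cartesianProductWith f xs ys) ⟩
    length ys + length xs * length ys ∎
    where open ≡-Reasoning

  matching : ℕ → (A → Cantor) → Cantor → List A → List A
  matching k p W = filter (λ x → agree? k (p x) W)

  withBit : (A → Cantor) → Bool → List A → List A
  withBit p b = filter (λ x → p x 0 Bool.≟ b)

  length-withBit : ∀ p xs → length (withBit p true xs) + length (withBit p false xs) ≡ length xs
  length-withBit p xs = begin
    length (withBit p true xs) + length (withBit p false xs)
      ≡⟨ cong (λ ys → length (withBit p true xs) + length ys) (filter-≐ _ _ false⇔≢true xs) ⟩
    length (withBit p true xs) + length (filter (∁? (λ x → p x 0 Bool.≟ true)) xs)
      ≡⟨ length-filter-∁ (λ x → p x 0 Bool.≟ true) xs ⟩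
    length xs ∎
    where
    open ≡-Reasoning
    false⇔≢true : (λ x → p x 0 ≡ false) ≐ (λ x → ¬ p x 0 ≡ true)
    false⇔≢true = (λ ≡false ≡true → contradiction (trans (sym ≡true) ≡false) λ ())
                , ¬-not

  matching-zero : ∀ p W xs → matching 0 p W xs ≡ xs
  matching-zero p W xs = filter-all _ (All.tabulate λ _ ())

  matching-∷ᶜ : ∀ k p b W xs →
                matching (suc k) p (b ∷ᶜ W) xs ≡ matching k (shift 1 ∘ p) W (withBit p b xs)
  matching-∷ᶜ k p b W xs = begin
    matching (suc k) p (b ∷ᶜ W) xs
      ≡⟨ filter-≐ agree-all? (bit? ∩? agree-tail?)
                  (Agree-∷ᶜ⁻ , λ {x} (≡b , ≈W) → Agree-∷ᶜ⁺ {f = p x} ≡b ≈W) xs ⟩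
    filter (bit? ∩? agree-tail?) xs
      ≡⟨ sym (filter-filter bit? agree-tail? xs) ⟩
    matching k (shift 1 ∘ p) W (withBit p b xs) ∎
    where
    open ≡-Reasoning
    agree-all? = λ x → agree? (suc k) (p x) (b ∷ᶜ W)
    bit? = λ x → p x 0 Bool.≟ b
    agree-tail? = λ x → agree? k (shift 1 (p x)) W

  popular-prefix : ∀ k (p : A → Cantor) xs → ∃[ W ] length xs ≤ 2 ^ k * length (matching k p W xs)
  popular-prefix zero p xs =
    zeros , ≤-reflexive (trans (cong length (sym (matching-zero p zeros xs))) (sym (+-identityʳ _)))
  popular-prefix (suc k) p xs = b ∷ᶜ W , (begin
    length xs                                           ≤⟨ xs≤2ys ⟩
    2 * length ys                                       ≤⟨ *-monoʳ-≤ 2 ys≤ ⟩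
    2 * (2 ^ k * length (matching k p′ W ys))           ≡⟨ sym (*-assoc 2 (2 ^ k) _) ⟩
    2 ^ suc k * length (matching k p′ W ys)             ≡⟨ cong (λ zs → 2 ^ suc k * length zs)
                                                                 (sym (matching-∷ᶜ k p b W xs)) ⟩
    2 ^ suc k * length (matching (suc k) p (b ∷ᶜ W) xs) ∎)
    where
    open ≤-Reasoning
    larger-half : ∃[ b ] length xs ≤ 2 * length (withBit p b xs)
    larger-half with ≤-total (length (withBit p true xs)) (length (withBit p false xs))
    ... | inj₁ t≤f = false , proj₁ (halves (length-withBit p xs) t≤f)
    ... | inj₂ f≤t = true , proj₁ (halves (trans (+-comm (length (withBit p false xs)) _)
                                                (length-withBit p xs)) f≤t)
    b = proj₁ larger-half
    xs≤2ys = proj₂ larger-half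
    ys = withBit p b xs
    p′ = shift 1 ∘ p
    W = proj₁ (popular-prefix k p′ ys)
    ys≤ = proj₂ (popular-prefix k p′ ys)

  rare-prefix : ∀ k (p : A → Cantor) xs → ∃[ W ] 2 ^ k * length (matching k p W xs) ≤ length xs
  rare-prefix zero p xs =
    zeros , ≤-reflexive (trans (+-identityʳ _) (cong length (matching-zero p zeros xs)))
  rare-prefix (suc k) p xs = b ∷ᶜ W , (begin
    2 ^ suc k * length (matching (suc k) p (b ∷ᶜ W) xs) ≡⟨ cong (λ zs → 2 ^ suc k * length zs)
                                                                 (matching-∷ᶜ k p b W xs) ⟩
    2 ^ suc k * length (matching k p′ W ys)             ≡⟨ *-assoc 2 (2 ^ k) _ ⟩
    2 * (2 ^ k * length (matching k p′ W ys))           ≤⟨ *-monoʳ-≤ 2 ys≥ ⟩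
    2 * length ys                                       ≤⟨ 2ys≤xs ⟩
    length xs                                           ∎)
    where
    open ≤-Reasoning
    smaller-half : ∃[ b ] 2 * length (withBit p b xs) ≤ length xs
    smaller-half with ≤-total (length (withBit p true xs)) (length (withBit p false xs))
    ... | inj₁ t≤f = true , proj₂ (halves (length-withBit p xs) t≤f)
    ... | inj₂ f≤t = false , proj₂ (halves (trans (+-comm (length (withBit p false xs)) _)
                                                 (length-withBit p xs)) f≤t)
    b = proj₁ smaller-half
    2ys≤xs = proj₂ smaller-half
    ys = withBit p b xs
    p′ = shift 1 ∘ p
    W = proj₁ (rare-prefix k p′ ys)
    ys≥ = proj₂ (rare-prefix k p′ ys)

  avoid-prefixes : ∀ b (p : A → Cantor) xs → length xs < 2 ^ b →
                   ∃[ D ] ∀ {x} → x ∈ xs → ¬ Agree b (p x) D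
  avoid-prefixes b p xs xs<2^b = D , λ x∈xs px≈D → <⇒≱ xs<2^b (begin
    2 ^ b
      ≡⟨ sym (*-identityʳ (2 ^ b)) ⟩
    2 ^ b * 1
      ≤⟨ *-monoʳ-≤ (2 ^ b) (∈-length (∈-filter⁺ (λ y → agree? b (p y) D) x∈xs px≈D)) ⟩
    2 ^ b * length (matching b p D xs)
      ≤⟨ proj₂ (rare-prefix b p xs) ⟩
    length xs ∎)
    where
    open ≤-Reasoning
    D = proj₁ (rare-prefix b p xs)

-- Killing finitely many translates inside a porous set's holes

module _ {A : Set} (f : A → A) where

  iterate-+ : ∀ m {n} a → iterate f a (m + n) ≡ iterate f (iterate f a m) n
  iterate-+ zero a = refl
  iterate-+ (suc m) a = iterate-+ m (f a)

  module _ (size : A → ℕ) (K : ℕ) .{{_ : NonZero K}}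
           (shrinks : ∀ a → size a + K * size (f a) ≤ K * size a) where

    size-iterate : ∀ r a → r * size (iterate f a r) + K * size (iterate f a r) ≤ K * size a
    size-iterate zero a = ≤-refl
    size-iterate (suc r) a = begin
      suc r * n + K * n       ≡⟨ +-assoc n (r * n) (K * n) ⟩
      n + (r * n + K * n)     ≤⟨ +-mono-≤ n≤size-a (size-iterate r (f a)) ⟩
      size a + K * size (f a) ≤⟨ shrinks a ⟩
      K * size a              ∎
      where
      open ≤-Reasoning
      n = size (iterate f (f a) r)
      n≤size-a : n ≤ size a
      n≤size-a = ≤-trans (*-cancelˡ-≤ K (≤-trans (m≤n+m (K * n) (r * n)) (size-iterate r (f a))))
                         (*-cancelˡ-≤ K (≤-trans (m≤n+m (K * size (f a)) (size a)) (shrinks a)))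

    halves-every-K-steps : ∀ a → 2 * size (iterate f a K) ≤ size a
    halves-every-K-steps a = *-cancelˡ-≤ K (begin
      K * (2 * n)   ≡⟨ cong (K *_) (cong (n +_) (+-identityʳ n)) ⟩
      K * (n + n)   ≡⟨ *-distribˡ-+ K n n ⟩
      K * n + K * n ≤⟨ size-iterate K a ⟩
      K * size a    ∎)
      where
      open ≤-Reasoning
      n = size (iterate f a K)

    decay : ∀ R a → 2 ^ R * size (iterate f a (R * K)) ≤ size a
    decay zero a = ≤-reflexive (+-identityʳ (size a))
    decay (suc R) a = begin
      2 ^ suc R * size (iterate f a (K + R * K))             ≡⟨ cong (λ b → 2 ^ suc R * size b)
                                                                     (iterate-+ K a) ⟩
      2 ^ suc R * size (iterate f (iterate f a K) (R * K))   ≡⟨ *-assoc 2 (2 ^ R) _ ⟩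
      2 * (2 ^ R * size (iterate f (iterate f a K) (R * K))) ≤⟨ *-monoʳ-≤ 2 (decay R (iterate f a K)) ⟩
      2 * size (iterate f a K)                               ≤⟨ halves-every-K-steps a ⟩
      size a                                                 ∎
      where open ≤-Reasoning

-- A step writes into the point, from `front` on, the k bits that porosity asks for from the largest
-- number of live candidates u. Candidates vanish from `front` on, so these are also the next bits
-- of point ⊕ u, which then lies in a hole of P: at least a 2^-k fraction of the live candidates dies.
module Killing {P : Subset} {k : ℕ} (porous : PorousWith k P) where

  record State : Set where
    constructor state
    field
      point : Cantor
      front : ℕ
      live  : List Cantor
  open State

  Killed : State → Cantor → Set
  Killed s u = Misses P (front s) (point s ⊕ u)

  hole : State → Cantor → Cantor
  hole s u = proj₁ (porous (point s ⊕ u) (front s))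

  holePattern : State → Cantor → Cantor
  holePattern s u = shift (front s) (hole s u)

  winner : State → Cantor
  winner s = proj₁ (popular-prefix k (holePattern s) (live s))

  hit? : ∀ s → Decidable (λ u → Agree k (holePattern s u) (winner s))
  hit? s u = agree? k (holePattern s u) (winner s)

  step : State → State
  step s = state (graft (front s) (point s) (winner s)) (front s + k) (filter (∁? (hit? s)) (live s))

  step-point : ∀ s → Agree (front s) (point s) (point (step s))
  step-point s i<q = sym (graft-< (point s) (winner s) i<q)

  step-kills : ∀ s {u} → VanishesFrom (front s) u → Agree k (holePattern s u) (winner s) →
               Killed (step s) u
  step-kills s {u} u-vanishes u-hit = Misses-Agree (Agree-sym stepped≈hole) hole-misses
    where
    q = front s
    hole-agrees = proj₁ (proj₂ (porous (point s ⊕ u) q))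
    hole-misses = proj₂ (proj₂ (porous (point s ⊕ u) q))
    stepped≈hole : Agree (q + k) (point (step s) ⊕ u) (hole s u)
    stepped≈hole = Agree-+ q
      (Agree-trans (Agree-⊕ (Agree-sym (step-point s)) (Agree-refl {f = u})) hole-agrees)
      λ {o} o<k → begin
        graft q (point s) (winner s) (q + o) xor u (q + o) ≡⟨ cong₂ _xor_ (graft-+ q (point s) (winner s))
                                                                          (u-vanishes (m≤m+n q o)) ⟩
        winner s o xor false                               ≡⟨ xor-identityʳ (winner s o) ⟩
        winner s o                                         ≡⟨ sym (u-hit o<k) ⟩
        hole s u (q + o)                                   ∎
      where open ≡-Reasoning

  step-live : ∀ s {u} → VanishesFrom (front s) u → u ∈ live s →
              u ∈ live (step s) ⊎ Killed (step s) u
  step-live s {u} u-vanishes u∈ with hit? s u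
  ... | yes u-hit = inj₂ (step-kills s u-vanishes u-hit)
  ... | no u-missed = inj₁ (∈-filter⁺ (∁? (hit? s)) u∈ u-missed)

  private instance
    2^k≢0 : NonZero (2 ^ k)
    2^k≢0 = m^n≢0 2 k

  step-shrinks : ∀ s → length (live s) + 2 ^ k * length (live (step s)) ≤ 2 ^ k * length (live s)
  step-shrinks s = begin
    length (live s) + 2 ^ k * survivors ≤⟨ +-monoˡ-≤ _ (proj₂ (popular-prefix k (holePattern s) (live s))) ⟩
    2 ^ k * killed + 2 ^ k * survivors  ≡⟨ sym (*-distribˡ-+ (2 ^ k) killed survivors) ⟩
    2 ^ k * (killed + survivors)        ≡⟨ cong (2 ^ k *_) (length-filter-∁ (hit? s) (live s)) ⟩
    2 ^ k * length (live s)             ∎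
    where
    open ≤-Reasoning
    killed = length (filter (hit? s) (live s))
    survivors = length (live (step s))

  Killed-persists : ∀ {s s′ u} → Agree (front s) (point s) (point s′) → front s ≤ front s′ →
                    Killed s u → Killed s′ u
  Killed-persists {u = u} s≈s′ s≤s′ killed =
    Misses-≤ s≤s′ (Misses-Agree (Agree-⊕ s≈s′ (Agree-refl {f = u})) killed)

  front-iterate : ∀ r s → front (iterate step s r) ≡ front s + r * k
  front-iterate zero s = sym (+-identityʳ (front s))
  front-iterate (suc r) s = trans (front-iterate r (step s)) (+-assoc (front s) k (r * k))

  front-iterate-≥ : ∀ r s → front s ≤ front (iterate step s r)
  front-iterate-≥ r s = subst (front s ≤_) (sym (front-iterate r s)) (m≤m+n (front s) (r * k))

  point-iterate : ∀ r s → Agree (front s) (point s) (point (iterate step s r))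
  point-iterate zero s = Agree-refl {f = point s}
  point-iterate (suc r) s =
    Agree-trans (step-point s) (Agree-≤ (m≤m+n (front s) k) (point-iterate r (step s)))

  live-iterate : ∀ r s {u} → VanishesFrom (front s) u → u ∈ live s →
                 u ∈ live (iterate step s r) ⊎ Killed (iterate step s r) u
  live-iterate zero s _ u∈ = inj₁ u∈
  live-iterate (suc r) s {u} u-vanishes u∈ with step-live s u-vanishes u∈
  ... | inj₁ u∈′ =
    live-iterate r (step s) (λ q+k≤i → u-vanishes (≤-trans (m≤m+n _ k) q+k≤i)) u∈′
  ... | inj₂ killed = inj₂ (Killed-persists {step s} {iterate step (step s) r} {u}
                              (point-iterate r (step s)) (front-iterate-≥ r (step s)) killed)

  kill : ∀ R (U : List Cantor) → length U < 2 ^ R →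
         ∀ z q → (∀ {u} → u ∈ U → VanishesFrom q u) →
         Σ Cantor λ z′ → Agree q z z′ × (∀ {u} → u ∈ U → Misses P (q + R * 2 ^ k * k) (z′ ⊕ u))
  kill R U U<2^R z q U-vanishes = point final , point-iterate steps initial , killed
    where
    initial = state z q U
    steps = R * 2 ^ k
    final = iterate step initial steps
    nobody-survives : ∀ {u} → ¬ u ∈ live final
    nobody-survives u∈ = <⇒≱ U<2^R (begin
      2 ^ R                       ≤⟨ m≤m*n (2 ^ R) (length (live final)) {{>-nonZero (∈-length u∈)}} ⟩
      2 ^ R * length (live final) ≤⟨ decay step (length ∘ live) (2 ^ k) step-shrinks R initial ⟩
      length U                    ∎)
      where open ≤-Reasoning
    killed : ∀ {u} → u ∈ U → Misses P (q + R * 2 ^ k * k) (point final ⊕ u)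
    killed u∈ with live-iterate steps initial (U-vanishes u∈) u∈
    ... | inj₁ u∈final = contradiction u∈final nobody-survives
    ... | inj₂ u-killed = subst (λ n → Misses P n (point final ⊕ _)) (front-iterate steps initial) u-killed

module SegmentRecursion (S : ℕ → ℕ) (S-< : ∀ t → S t < S (suc t)) (next : ℕ → Cantor → Cantor)
                        (next-fixes : ∀ t f → Agree (S t) f (next t f)) where

  stage : ℕ → Cantor
  stage zero = zeros
  stage (suc t) = next t (stage t)

  limit : Cantor
  limit i = stage (suc i) i

  S-mono : ∀ {t t′} → t ≤ t′ → S t ≤ S t′
  S-mono {t′ = zero} z≤n = ≤-refl
  S-mono {t} {suc t′} t≤1+t′ with t ≤? t′
  ... | yes t≤t′ = ≤-trans (S-mono t≤t′) (<⇒≤ (S-< t′))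
  ... | no t≰t′ = ≤-reflexive (cong S (≤-antisym t≤1+t′ (≰⇒> t≰t′)))

  n<S[1+n] : ∀ n → n < S (suc n)
  n<S[1+n] zero = ≤-<-trans z≤n (S-< 0)
  n<S[1+n] (suc n) = ≤-<-trans (n<S[1+n] n) (S-< (suc n))

  stage-stable : ∀ {t t′} → t ≤ t′ → Agree (S t) (stage t) (stage t′)
  stage-stable {t} {zero} z≤n = Agree-refl {f = stage t}
  stage-stable {t} {suc t′} t≤1+t′ with t ≤? t′
  ... | yes t≤t′ =
    Agree-trans (stage-stable t≤t′) (Agree-≤ (S-mono t≤t′) (next-fixes t′ (stage t′)))
  ... | no t≰t′ rewrite ≤-antisym t≤1+t′ (≰⇒> t≰t′) = Agree-refl {f = stage (suc t′)}

  limit-agrees : ∀ t → Agree (S t) limit (stage t)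
  limit-agrees t {i} i<St with ≤-total t (suc i)
  ... | inj₁ t≤1+i = sym (stage-stable t≤1+i i<St)
  ... | inj₂ 1+i≤t = stage-stable 1+i≤t (n<S[1+n] i)

-- Segments, blocks and gaps

blockLen gapLen : ℕ → ℕ
blockLen t = 2 ^ t
gapLen t = 2 ^ blockLen t

segStart gapStart : ℕ → ℕ
segStart zero = 0
segStart (suc t) = segStart t + blockLen t + gapLen t
gapStart t = segStart t + blockLen t

gapLen≢0 : ∀ t → NonZero (gapLen t)
gapLen≢0 t = m^n≢0 2 (blockLen t)

segStart-< : ∀ t → segStart t < segStart (suc t)
segStart-< t = <-≤-trans (m<m+n (segStart t) (m^n>0 2 t)) (m≤m+n (gapStart t) (gapLen t))

n<2^n : ∀ n → n < 2 ^ n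
n<2^n zero = z<s
n<2^n (suc n) = subst (suc (suc n) ≤_) (cong (2 ^ n +_) (sym (+-identityʳ (2 ^ n))))
                      (+-mono-≤ (m^n>0 2 n) (n<2^n n))

n+n≤2^n : ∀ n → n + n ≤ 2 ^ n
n+n≤2^n zero = z≤n
n+n≤2^n (suc n) = subst (suc n + suc n ≤_) (cong (2 ^ n +_) (sym (+-identityʳ (2 ^ n))))
                        (+-mono-≤ (n<2^n n) (n<2^n n))

gapLen-suc : ∀ t → gapLen (suc t) ≡ gapLen t * gapLen t
gapLen-suc t = trans (cong (λ e → 2 ^ (2 ^ t + e)) (+-identityʳ (2 ^ t))) (^-distribˡ-+-* 2 (2 ^ t) (2 ^ t))

gapLen-< : ∀ t → gapLen t < gapLen (suc t)
gapLen-< t = ^-monoʳ-< 2 (s≤s (s≤s z≤n)) (^-monoʳ-< 2 (s≤s (s≤s z≤n)) (n<1+n t))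

ZeroOnGaps : Subset
ZeroOnGaps x = ∀ t o → o < gapLen t → x (gapStart t + o) ≡ false

withBlock : ℕ → Cantor → Cantor → Cantor
withBlock t f v = graft (segStart t) f (graft (blockLen t) v zeros)

withBlock-fixes : ∀ t f v → Agree (segStart t) f (withBlock t f v)
withBlock-fixes t f v i<start = sym (graft-< f _ i<start)

withBlock-block : ∀ t f v {o} → o < blockLen t → withBlock t f v (segStart t + o) ≡ v o
withBlock-block t f v o<len = trans (graft-+ (segStart t) f _) (graft-< v zeros o<len)

withBlock-gap : ∀ t f v o → withBlock t f v (gapStart t + o) ≡ false
withBlock-gap t f v o = begin
  withBlock t f v (segStart t + blockLen t + o)   ≡⟨ cong (withBlock t f v)
                                                          (+-assoc (segStart t) (blockLen t) o) ⟩
  withBlock t f v (segStart t + (blockLen t + o)) ≡⟨ graft-+ (segStart t) f _ ⟩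
  graft (blockLen t) v zeros (blockLen t + o)     ≡⟨ graft-+ (blockLen t) v zeros ⟩
  false                                           ∎
  where open ≡-Reasoning

withBlock-vanishes : ∀ t f v → VanishesFrom (gapStart t) (withBlock t f v)
withBlock-vanishes t f v gapStart≤i with m≤n⇒∃[o]m+o≡n gapStart≤i
... | o , refl = withBlock-gap t f v o

withBlock-Agree : ∀ {t u v a} → ZeroOnGaps a →
                  Agree (segStart t) u a → Agree (blockLen t) v (shift (segStart t) a) →
                  Agree (segStart (suc t)) (withBlock t u v) a
withBlock-Agree {t} {u} {v} a-zero u≈a v≈a =
  Agree-+ (gapStart t)
    (Agree-+ (segStart t) (Agree-trans (Agree-sym (withBlock-fixes t u v)) u≈a)
                          (λ o<len → trans (withBlock-block t u v o<len) (v≈a o<len)))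
    λ {o} o<len → trans (withBlock-gap t u v o) (sym (a-zero t o o<len))

allPrefixes : ℕ → List Cantor
allPrefixes zero = zeros ∷ []
allPrefixes (suc b) = cartesianProductWith _∷ᶜ_ (true ∷ false ∷ []) (allPrefixes b)

length-allPrefixes : ∀ b → length (allPrefixes b) ≡ 2 ^ b
length-allPrefixes zero = refl
length-allPrefixes (suc b) =
  trans (length-cartesianProductWith _∷ᶜ_ (true ∷ false ∷ []) (allPrefixes b))
        (cong (2 *_) (length-allPrefixes b))

allPrefixes-complete : ∀ b f → ∃[ v ] v ∈ allPrefixes b × Agree b v f
allPrefixes-complete zero f = zeros , here refl , λ ()
allPrefixes-complete (suc b) f with allPrefixes-complete b (shift 1 f)
... | v , v∈ , v≈f = f 0 ∷ᶜ v , ∈-cartesianProductWith⁺ _∷ᶜ_ (bit∈ (f 0)) v∈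
                   , Agree-sym (Agree-∷ᶜ⁺ {f = f} refl (Agree-sym v≈f))
  where
  bit∈ : ∀ b → b ∈ true ∷ false ∷ []
  bit∈ true = here refl
  bit∈ false = there (here refl)

candidates : ℕ → List Cantor
candidates zero = zeros ∷ []
candidates (suc t) = cartesianProductWith (withBlock t) (candidates t) (allPrefixes (blockLen t))

candidates-length : ∀ t → length (candidates t) < gapLen t
candidates-length zero = s≤s (s≤s z≤n)
candidates-length (suc t) = begin-strict
  length (candidates (suc t))
    ≡⟨ length-cartesianProductWith (withBlock t) (candidates t) _ ⟩
  length (candidates t) * length (allPrefixes (blockLen t))
    ≡⟨ cong (length (candidates t) *_) (length-allPrefixes (blockLen t)) ⟩
  length (candidates t) * gapLen t
    <⟨ *-monoˡ-< (gapLen t) {{gapLen≢0 t}} (candidates-length t) ⟩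
  gapLen t * gapLen t
    ≡⟨ sym (gapLen-suc t) ⟩
  gapLen (suc t) ∎
  where open ≤-Reasoning

candidates-vanish : ∀ t {u} → u ∈ candidates (suc t) → VanishesFrom (gapStart t) u
candidates-vanish t u∈ with ∈-cartesianProductWith⁻ (withBlock t) (candidates t) _ u∈
... | u′ , v , _ , _ , refl = withBlock-vanishes t u′ v

candidates-complete : ∀ {a} → ZeroOnGaps a → ∀ t → ∃[ u ] u ∈ candidates t × Agree (segStart t) u a
candidates-complete a-zero zero = zeros , here refl , λ ()
candidates-complete {a} a-zero (suc t)
  with candidates-complete a-zero t | allPrefixes-complete (blockLen t) (shift (segStart t) a)
... | u , u∈ , u≈a | v , v∈ , v≈a =
  withBlock t u v , ∈-cartesianProductWith⁺ (withBlock t) u∈ v∈ , withBlock-Agree {t} a-zero u≈a v≈a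

-- ZeroOnGaps is not microscopic

locate : (b : ℕ → ℕ) → b 0 ≡ 0 → (∀ t → b t < b (suc t)) →
         ∀ j → ∃[ t ] b t ≤ j × j < b (suc t)
locate b b0≡0 b-< zero = 0 , ≤-reflexive b0≡0 , subst (_< b 1) b0≡0 (b-< 0)
locate b b0≡0 b-< (suc j) with locate b b0≡0 b-< j
... | t , bt≤j , j<b with suc j <? b (suc t)
...   | yes 1+j<b = t , m≤n⇒m≤1+n bt≤j , 1+j<b
...   | no 1+j≮b = suc t , ≤-reflexive b≡1+j , subst (_< b (suc (suc t))) b≡1+j (b-< (suc t))
  where
  b≡1+j : b (suc t) ≡ suc j
  b≡1+j = ≤-antisym (≮⇒≥ 1+j≮b) j<b

-- Block t disagrees with every σ j, j < threshold (suc t); once threshold t ≤ j,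
-- σ j is long enough to cover block t (gapStart-≤).
threshold : ℕ → ℕ
threshold zero = 0
threshold (suc t) = pred (gapLen t)

suc-threshold : ∀ t → suc (threshold (suc t)) ≡ gapLen t
suc-threshold t = suc-pred (gapLen t) {{gapLen≢0 t}}

threshold-< : ∀ t → threshold t < threshold (suc t)
threshold-< zero = s≤s z≤n
threshold-< (suc t) = s<s⁻¹ (subst₂ _<_ (sym (suc-threshold t)) (sym (suc-threshold (suc t))) (gapLen-< t))

8*m+m*m+4*m≤8*[m*m] : ∀ {m} → 2 ≤ m → 8 * m + m * m + 4 * m ≤ 8 * (m * m)
8*m+m*m+4*m≤8*[m*m] {m} 2≤m = begin
  8 * m + m * m + 4 * m ≡⟨ solve 1 (λ m → con 8 :* m :+ m :* m :+ con 4 :* m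
                                       := m :* m :+ con 6 :* (con 2 :* m)) refl m ⟩
  m * m + 6 * (2 * m)   ≤⟨ +-monoʳ-≤ (m * m) (*-monoʳ-≤ 6 (*-monoˡ-≤ m 2≤m)) ⟩
  7 * (m * m)           ≤⟨ m≤n+m (7 * (m * m)) (m * m) ⟩
  8 * (m * m)           ∎
  where
  open ≤-Reasoning
  open +-*-Solver

gapStart-suc-≤ : ∀ t → gapStart (suc t) ≤ 8 * gapLen t
gapStart-suc-≤ zero = m≤m+n 5 11
gapStart-suc-≤ (suc t) = begin
  gapStart (suc t) + gapLen (suc t) + blockLen (suc (suc t))
    ≤⟨ +-mono-≤ (+-mono-≤ (gapStart-suc-≤ t) (≤-reflexive (gapLen-suc t))) blockLen≤ ⟩
  8 * g + g * g + 4 * g ≤⟨ 8*m+m*m+4*m≤8*[m*m] (^-monoʳ-≤ 2 (m^n>0 2 t)) ⟩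
  8 * (g * g)           ≡⟨ cong (8 *_) (sym (gapLen-suc t)) ⟩
  8 * gapLen (suc t)    ∎
  where
  open ≤-Reasoning
  g = gapLen t
  blockLen≤ : blockLen (suc (suc t)) ≤ 4 * g
  blockLen≤ = subst (_≤ 4 * g) (*-assoc 2 2 (2 ^ t)) (*-monoʳ-≤ 4 (^-monoʳ-≤ 2 (<⇒≤ (n<2^n t))))

gapStart-≤ : ∀ t → gapStart t ≤ 8 * suc (threshold t)
gapStart-≤ zero = s≤s z≤n
gapStart-≤ (suc t) = subst (λ n → gapStart (suc t) ≤ 8 * n) (sym (suc-threshold t)) (gapStart-suc-≤ t)

ZeroOnGaps-not-microscopic : ¬ Microscopic ZeroOnGaps
ZeroOnGaps-not-microscopic microscopic with microscopic 8
... | σ , covers = escapes (covers a a∈ZeroOnGaps)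
  where
  blockOf : ℕ → ℕ → Cantor
  blockOf t j = shift (segStart t) (toCantor (σ j))

  avoiding : ∀ t → ∃[ D ] ∀ {j} → j ∈ upTo (threshold (suc t)) →
                                   ¬ Agree (blockLen t) (blockOf t j) D
  avoiding t = avoid-prefixes (blockLen t) (blockOf t) (upTo (threshold (suc t)))
    (subst (_< gapLen t) (sym (length-upTo _)) (m≤pred[n]⇒suc[m]≤n {{gapLen≢0 t}} ≤-refl))

  open SegmentRecursion segStart segStart-< (λ t f → withBlock t f (proj₁ (avoiding t)))
                        (λ t f → withBlock-fixes t f _)

  a : Cantor
  a = limit

  a-block : ∀ t {o} → o < blockLen t → a (segStart t + o) ≡ proj₁ (avoiding t) o
  a-block t o<len =
    trans (limit-agrees (suc t) (<-≤-trans (+-monoʳ-< (segStart t) o<len) (m≤m+n (gapStart t) (gapLen t))))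
          (withBlock-block t _ _ o<len)

  a∈ZeroOnGaps : ZeroOnGaps a
  a∈ZeroOnGaps t o o<len = trans (limit-agrees (suc t) (+-monoʳ-< (gapStart t) o<len)) (withBlock-gap t _ _ o)

  escapes : ¬ (∃[ j ] a ∈[ σ j ])
  escapes (j , a∈σj) with locate threshold refl threshold-< j
  ... | t , threshold≤j , j<threshold = proj₂ (avoiding t) (∈-applyUpTo⁺ id j<threshold) σj≈D
    where
    σj≈D : Agree (blockLen t) (blockOf t j) (proj₁ (avoiding t))
    σj≈D {o} o<len = trans (∈[]⇒Agree {x = a} {σ j} a∈σj (begin-strict
        segStart t + o        <⟨ +-monoʳ-< (segStart t) o<len ⟩
        gapStart t            ≤⟨ gapStart-≤ t ⟩
        8 * suc (threshold t) ≤⟨ *-monoʳ-≤ 8 (s≤s threshold≤j) ⟩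
        8 * suc j             ∎))
      (a-block t o<len)
      where open ≤-Reasoning

-- ZeroOnGaps belongs to (σP)*

countdown : ℕ × ℕ → ℕ × ℕ
countdown (suc i , r) = i , r
countdown (zero , r) = suc r , suc r

schedule : ℕ → ℕ × ℕ
schedule zero = 0 , 0
schedule (suc t) = countdown (schedule t)

schedule-descends : ∀ j {i r t} → schedule t ≡ (j + i , r) → schedule (j + t) ≡ (i , r)
schedule-descends zero eq = eq
schedule-descends (suc j) {i} {r} {t} eq =
  subst (λ t′ → schedule t′ ≡ (i , r)) (+-suc j t) (schedule-descends j (cong countdown eq))

schedule-top : ∀ r → ∃[ t ] schedule t ≡ (r , r)
schedule-top zero = 0 , refl
schedule-top (suc r) with schedule-top r
... | t , eq = suc (r + t) , cong countdown (schedule-descends r (trans eq (cong (_, r) (sym (+-identityʳ r)))))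

schedule-visits : ∀ n r → ∃[ t ] r ≤ t × proj₁ (schedule t) ≡ n
schedule-visits n r with schedule-top (r + n)
... | t , eq = r + t , m≤m+n r t , cong proj₁ (schedule-descends r eq)

killing-fits-gap : ∀ t k → k + k < t → blockLen (suc t) * 2 ^ k * k ≤ gapLen t
killing-fits-gap t k k+k<t = begin
  2 ^ suc t * 2 ^ k * k     ≤⟨ *-monoʳ-≤ (2 ^ suc t * 2 ^ k) (<⇒≤ (n<2^n k)) ⟩
  2 ^ suc t * 2 ^ k * 2 ^ k ≡⟨ cong (_* 2 ^ k) (sym (^-distribˡ-+-* 2 (suc t) k)) ⟩
  2 ^ (suc t + k) * 2 ^ k   ≡⟨ sym (^-distribˡ-+-* 2 (suc t + k) k) ⟩
  2 ^ (suc t + k + k)       ≤⟨ ^-monoʳ-≤ 2 exponent≤ ⟩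
  2 ^ 2 ^ t                 ∎
  where
  open ≤-Reasoning
  exponent≤ : suc t + k + k ≤ 2 ^ t
  exponent≤ = begin
    suc t + k + k   ≡⟨ +-assoc (suc t) k k ⟩
    suc t + (k + k) ≡⟨ cong suc (+-comm t (k + k)) ⟩
    suc (k + k) + t ≤⟨ +-monoˡ-≤ t k+k<t ⟩
    t + t           ≤⟨ n+n≤2^n t ⟩
    2 ^ t           ∎

module Escape {P : ℕ → Subset} (P-porous : ∀ n → Porous (P n)) where

  depth : ℕ → ℕ
  depth n = proj₁ (Porous⇒PorousWith (P-porous n))

  task : ℕ → ℕ
  task t = proj₁ (schedule t)

  killingLength : ℕ → ℕ
  killingLength t = blockLen (suc t) * 2 ^ depth (task t) * depth (task t)

  killInGap : ∀ t f → Σ Cantor λ z′ → Agree (gapStart t) f z′ ×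
              (∀ {u} → u ∈ candidates (suc t) →
                       Misses (P (task t)) (gapStart t + killingLength t) (z′ ⊕ u))
  killInGap t f = Killing.kill (proj₂ (Porous⇒PorousWith (P-porous (task t))))
                    (blockLen (suc t)) (candidates (suc t)) (candidates-length (suc t))
                    f (gapStart t) (candidates-vanish t)

  open SegmentRecursion segStart segStart-< (λ t f → proj₁ (killInGap t f))
    (λ t f → Agree-≤ (m≤m+n (segStart t) (blockLen t)) (proj₁ (proj₂ (killInGap t f))))

  z : Cantor
  z = limit

  escapes : ∀ {t n a} → task t ≡ n → depth n + depth n < t → ZeroOnGaps a →
            Misses (P n) (segStart (suc t)) (z ⊕ a)
  escapes {t} refl k+k<t a∈A with candidates-complete a∈A (suc t)
  ... | u , u∈ , u≈a =
    Misses-Agree (Agree-⊕ (Agree-sym (limit-agrees (suc t))) u≈a)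
                 (Misses-≤ (+-monoʳ-≤ (gapStart t) (killing-fits-gap t _ k+k<t))
                           (proj₂ (proj₂ (killInGap t (stage t))) u∈))

  z∉A+F : ∀ {F : Subset} → (∀ x → F x → ∃[ n ] P n x) → ¬ (ZeroOnGaps +ₛ F) z
  z∉A+F F⊆⋃P (a , b , a∈A , b∈F , z≡a⊕b) with F⊆⋃P b b∈F
  ... | n , b∈Pn with schedule-visits n (suc (depth n + depth n))
  ...   | t , k+k<t , scheduled = escapes scheduled k+k<t a∈A b z⊕a≈b b∈Pn
    where
    z⊕a≈b : Agree (segStart (suc t)) (z ⊕ a) b
    z⊕a≈b {i} _ = trans (cong (_xor a i) (z≡a⊕b i)) (xor-cancelˡ (a i) (b i))

ZeroOnGaps∈σP* : SigmaPorousStar ZeroOnGaps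
ZeroOnGaps∈σP* F (P , P-porous , F⊆⋃P , _) covers = z∉A+F F⊆⋃P (covers z)
  where open Escape P-porous

mainTheorem15 : ¬ SameFamily Micro SigmaPorousStar
mainTheorem15 same = ZeroOnGaps-not-microscopic (lower (proj₂ (same ZeroOnGaps) ZeroOnGaps∈σP*))
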